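{- Let $Z \subseteq \overline{\mathbb{F}}$ be a floating-point interval, let $x \in \mathbb{F}^*$ and $z \in Z$, and let $m_x = x\beta^{ -E(x)}$ and $m_z = z\beta^{ -E(z)}$. If $\operatorname{diam}\mathrm{fl}^{ -1}[Z] \ge \beta^{Q(z)}$, $|m_z| \le |m_x|$, and $\beta^{e_{\min}} \le |z/x| \le \max\mathbb{F}$, then $x$ is feasible for $Z$.
   Context: Floating-point format: integers $\beta \ge 2$, $p \ge 1$, $e_{\min} \le e_{\max}$. $\mathbb{F}^* = \{M\beta^{e-p+1} : M,e \in \mathbb{Z},\ 0<|M|<\beta^p,\ e_{\min}\le e\le e_{\max}\}$, $\mathbb{F} = \mathbb{F}^*\cup\{0\}$, $\overline{\mathbb{F}} = \mathbb{F}\cup\{ -\infty,+\infty\}$. For real $x$: $E(x) = \lfloor \log_\beta |x|\rfloor$ if $|x| \ge \beta^{e_{\min}}$, else $E(x) = e_{\min}$; $Q(x) = E(x)-p+1$. $\mathrm{RD}(x) = \max\{y\in\overline{\mathbb{F}} : y \le x\}$, $\mathrm{RU}(x) = \min\{y \in \overline{\mathbb{F}} : y \ge x\}$. $\mathrm{fl}:\overline{\mathbb{R}}\to\overline{\mathbb{F}}$ is a fixed nondecreasing rounding function with $\mathrm{fl}(x)\in\{\mathrm{RD}(x),\mathrm{RU}(x)\}$ for all $x$; $x\otimes y = \mathrm{fl}(xy)$ whenever the product is defined. $\operatorname{diam} X = \sup(\{d(a,b): a,b\in X\}\cup\{0\})$ with $d(a,b)=0$ if $a=b$ and $|a-b|$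 otherwise. A floating-point interval is a set $X\cap\overline{\mathbb{F}}$ with $X$ an extended-real interval. $x$ is feasible for $Z$ if $x\otimes y\in Z$ for some $y\in\overline{\mathbb{F}}$.
   Formalization: The rounding function fl is taken over the extended rationals rather than the extended reals, so the preimage $\mathrm{fl}^{ -1}[Z]$ in the diameter hypothesis consists of extended rationals. -}

module Defs where

open import Data.Nat as ℕ using (ℕ; zero; suc)
open import Data.Integer as ℤ using (ℤ; +_; -[1+_])
open import Data.Rational as ℚ using (ℚ; 0ℚ; _/_; ∣_∣; _*_; _-_; _≤_; _<_)
open import Data.Product using (Σ; ∃; ∃-syntax; _×_; _,_)
open import Data.Sum using (_⊎_)
open import Data.Unit using (⊤)
open import Relation.Binary.PropositionalEquality using (_≡_)
open import Relation.Nullary using (Dec; yes; no)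
open import Data.Bool using (Bool; true; false; if_then_else_)
open import Relation.Nullary.Decidable using (⌊_⌋)

record Format : Set where
  field
    β : ℕ
    p : ℕ
    emin : ℤ
    emax : ℤ
    2≤β : 2 ℕ.≤ β
    1≤p : 1 ℕ.≤ p
    emin≤emax : emin ℤ.≤ emax

-- Integer power of a natural base, as a rational (correct whenever base ≠ 0).
pow : ℕ → ℤ → ℚ
pow b (+ n) = (+ (b ℕ.^ n)) / 1
pow b -[1+ n ] with b ℕ.^ suc n
... | zero = 0ℚ
... | suc d = (+ 1) / suc d

-- Extended rationals (the ±∞ of the extended reals, with rational finite part).
data ℚ̄ : Set where
  -∞ +∞ : ℚ̄
  fin : ℚ → ℚ̄

data _≤ᴱ_ : ℚ̄ → ℚ̄ → Set where
  -∞≤ : ∀ {a} → -∞ ≤ᴱ a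
  ≤+∞ : ∀ {a} → a ≤ᴱ +∞
  fin≤ : ∀ {q r} → q ≤ r → fin q ≤ᴱ fin r

data _<ᴱ_ : ℚ̄ → ℚ̄ → Set where
  -∞<fin : ∀ {q} → -∞ <ᴱ fin q
  -∞<+∞ : -∞ <ᴱ +∞
  fin<+∞ : ∀ {q} → fin q <ᴱ +∞
  fin< : ∀ {q r} → q < r → fin q <ᴱ fin r

_≟ᴱ_ : (a b : ℚ̄) → Bool
-∞ ≟ᴱ -∞ = true
+∞ ≟ᴱ +∞ = true
fin q ≟ᴱ fin r = ⌊ q ℚ.≟ r ⌋
_ ≟ᴱ _ = false

dist : ℚ̄ → ℚ̄ → ℚ̄
dist a b = if a ≟ᴱ b then fin 0ℚ else dist' a b
  where
  dist' : ℚ̄ → ℚ̄ → ℚ̄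
  dist' (fin q) (fin r) = fin ∣ q - r ∣
  dist' _ _ = +∞

-- diam S ≥ c, where diam S = sup ({d(a,b) : a,b ∈ S} ∪ {0}):
-- every r < c is exceeded by some element of that set.
DiamGE : (ℚ̄ → Set) → ℚ → Set
DiamGE S c = ∀ (r : ℚ) → r < c →
  (r < 0ℚ) ⊎ (∃[ a ] ∃[ b ] (S a × S b × (fin r <ᴱ dist a b)))

IsInterval : (ℚ̄ → Set) → Set
IsInterval X = ∀ a b c → X a → X c → a ≤ᴱ b → b ≤ᴱ c → X b

data _·_≐_ : ℚ̄ → ℚ̄ → ℚ̄ → Set where
  ff : ∀ {q r} → fin q · fin r ≐ fin (q * r)
  pos+ : ∀ {q} → 0ℚ < q → fin q · +∞ ≐ +∞
  pos- : ∀ {q} → 0ℚ < q → fin q · -∞ ≐ -∞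
  neg+ : ∀ {q} → q < 0ℚ → fin q · +∞ ≐ -∞
  neg- : ∀ {q} → q < 0ℚ → fin q · -∞ ≐ +∞
  +pos : ∀ {q} → 0ℚ < q → +∞ · fin q ≐ +∞
  -pos : ∀ {q} → 0ℚ < q → -∞ · fin q ≐ -∞
  +neg : ∀ {q} → q < 0ℚ → +∞ · fin q ≐ -∞
  -neg : ∀ {q} → q < 0ℚ → -∞ · fin q ≐ +∞
  inf++ : +∞ · +∞ ≐ +∞
  inf-- : -∞ · -∞ ≐ +∞
  inf+- : +∞ · -∞ ≐ -∞
  inf-+ : -∞ · +∞ ≐ -∞

module _ (fmt : Format) where
  open Format fmt

  InF* : ℚ → Set
  InF* q = ∃[ M ] ∃[ e ]
    ((0 ℕ.< ℤ.∣ M ∣) × (ℤ.∣ M ∣ ℕ.< β ℕ.^ p) ×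
     (emin ℤ.≤ e) × (e ℤ.≤ emax) ×
     (q ≡ ((M / 1) * pow β (e ℤ.- + p ℤ.+ ℤ.1ℤ))))

  InF : ℚ → Set
  InF q = InF* q ⊎ q ≡ 0ℚ

  InF̄ : ℚ̄ → Set
  InF̄ -∞ = ⊤
  InF̄ +∞ = ⊤
  InF̄ (fin q) = InF q

  IsMaxF : ℚ → Set
  IsMaxF m = InF m × (∀ f → InF f → f ≤ m)

  IsRD : ℚ̄ → ℚ̄ → Set
  IsRD a y = InF̄ y × (y ≤ᴱ a) × (∀ f → InF̄ f → f ≤ᴱ a → f ≤ᴱ y)

  IsRU : ℚ̄ → ℚ̄ → Set
  IsRU a y = InF̄ y × (a ≤ᴱ y) × (∀ f → InF̄ f → a ≤ᴱ f → y ≤ᴱ f)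

  IsRounding : (ℚ̄ → ℚ̄) → Set
  IsRounding fl = (∀ a b → a ≤ᴱ b → fl a ≤ᴱ fl b) ×
                  (∀ a → IsRD a (fl a) ⊎ IsRU a (fl a))

  IsE : ℚ → ℤ → Set
  IsE x e = (pow β emin ≤ ∣ x ∣ × pow β e ≤ ∣ x ∣ × ∣ x ∣ < pow β (e ℤ.+ ℤ.1ℤ))
          ⊎ (∣ x ∣ < pow β emin × e ≡ emin)

  Qof : ℤ → ℤ
  Qof e = e ℤ.- + p ℤ.+ ℤ.1ℤ

  IsFPInterval : (ℚ̄ → Set) → Set₁
  IsFPInterval Z = Σ (ℚ̄ → Set) λ X → IsInterval X ×
    (∀ a → (Z a → X a × InF̄ a) × (X a × InF̄ a → Z a))

  Feasible : (ℚ̄ → ℚ̄) → ℚ̄ → (ℚ̄ → Set) → Set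
  Feasible fl x Z = ∃[ y ] ∃[ c ] (InF̄ y × (x · y ≐ c) × Z (fl c))

module Submission where

-- Put q = z / x and E = E(z) - E(x).  The hypotheses give β^emin ≤ |q| ≤ β^E and |q| ≤ max F, so
-- the floats of exponent E - 1 (clamped to the exponent range) give y₁ ≤ q ≤ y₂ in F with
-- y₂ - y₁ ≤ β^(E-p), and since |x| < β^(E(x)+1) the products x y₁ and x y₂ bracket z with a gap
-- smaller than β^Q(z).  The preimage fl⁻¹[Z] is an interval containing z (fl fixes floats) whose
-- diameter is at least β^Q(z), so it cannot fit strictly inside that bracket: it contains x y₁ or
-- x y₂, and the corresponding y makes x feasible.

open import Defs
open import Data.Nat as ℕ using (ℕ; zero; suc)
import Data.Nat.Properties as ℕP
open import Data.Integer as ℤ using (ℤ; +_; -[1+_]; +[1+_])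
import Data.Integer.Properties as ℤP
import Data.Integer.DivMod as ℤD
import Data.Nat.Coprimality as Coprime
open import Data.Rational as ℚ using (ℚ; mkℚ; 0ℚ; 1ℚ; _/_; ∣_∣; _*_; _+_; _-_; -_; _÷_; _≤_; _<_; NonZero; *≤*; *<*)
import Data.Rational.Properties as ℚP
open import Data.Empty using (⊥; ⊥-elim)
open import Algebra.Properties.Group ℚP.+-0-group using (⁻¹-involutive; ⁻¹-anti-homo-//)
open import Data.Product using (∃-syntax; _×_; _,_; proj₁; proj₂)
open import Data.Sum using (inj₁; inj₂)
open import Relation.Nullary using (Dec; yes; no)
open import Relation.Binary.PropositionalEquality
open import Data.Rational.Solver renaming (module +-*-Solver to ℚ-Solver)
open import Data.Integer.Solver renaming (module +-*-Solver to ℤ-Solver)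

fromℤ : ℤ → ℚ
fromℤ i = i / 1

fromℤ-normal : ∀ i → fromℤ i ≡ mkℚ i 0 (Coprime.sym (Coprime.1-coprimeTo ℤ.∣ i ∣))
fromℤ-normal (+ n) = ℚP.normalize-coprime (Coprime.sym (Coprime.1-coprimeTo n))
fromℤ-normal -[1+ n ] = cong -_ (ℚP.normalize-coprime (Coprime.sym (Coprime.1-coprimeTo (suc n))))

fromℤ-* : ∀ i j → fromℤ (i ℤ.* j) ≡ fromℤ i * fromℤ j
fromℤ-* i j rewrite fromℤ-normal i | fromℤ-normal j = refl

fromℤ-+ : ∀ i j → fromℤ (i ℤ.+ j) ≡ fromℤ i + fromℤ j
fromℤ-+ i j rewrite fromℤ-normal i | fromℤ-normal j | ℤP.*-identityʳ i | ℤP.*-identityʳ j = refl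

fromℤ-neg : ∀ i → fromℤ (ℤ.- i) ≡ - fromℤ i
fromℤ-neg (+ 0) = refl
fromℤ-neg (+ suc n) rewrite fromℤ-normal (+ suc n) = refl
fromℤ-neg -[1+ n ] rewrite fromℤ-normal -[1+ n ] | fromℤ-normal (+ suc n) = refl

fromℤ-∣∣ : ∀ i → fromℤ (+ ℤ.∣ i ∣) ≡ ∣ fromℤ i ∣
fromℤ-∣∣ i rewrite fromℤ-normal i | fromℤ-normal (+ ℤ.∣ i ∣) = refl

fromℤ-mono-≤ : ∀ {i j} → i ℤ.≤ j → fromℤ i ≤ fromℤ j
fromℤ-mono-≤ {i} {j} i≤j rewrite fromℤ-normal i | fromℤ-normal j =
  *≤* (subst₂ ℤ._≤_ (sym (ℤP.*-identityʳ i)) (sym (ℤP.*-identityʳ j)) i≤j)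

fromℤ-mono-< : ∀ {i j} → i ℤ.< j → fromℤ i < fromℤ j
fromℤ-mono-< {i} {j} i<j rewrite fromℤ-normal i | fromℤ-normal j =
  *<* (subst₂ ℤ._<_ (sym (ℤP.*-identityʳ i)) (sym (ℤP.*-identityʳ j)) i<j)

fromℤ-cancel-≤ : ∀ {i j} → fromℤ i ≤ fromℤ j → i ℤ.≤ j
fromℤ-cancel-≤ {i} {j} i≤j rewrite fromℤ-normal i | fromℤ-normal j with i≤j
... | *≤* i*1≤j*1 = subst₂ ℤ._≤_ (ℤP.*-identityʳ i) (ℤP.*-identityʳ j) i*1≤j*1

fromℤ-cancel-< : ∀ {i j} → fromℤ i < fromℤ j → i ℤ.< j
fromℤ-cancel-< {i} {j} i<j rewrite fromℤ-normal i | fromℤ-normal j with i<j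
... | *<* i*1<j*1 = subst₂ ℤ._<_ (ℤP.*-identityʳ i) (ℤP.*-identityʳ j) i*1<j*1

i<suc[j]⇒i≤j : ∀ {i j} → i ℤ.< ℤ.suc j → i ℤ.≤ j
i<suc[j]⇒i≤j i<suc[j] = ℤP.≮⇒≥ λ j<i → ℤP.<-irrefl refl (ℤP.<-≤-trans i<suc[j] (ℤP.i<j⇒suc[i]≤j j<i))

∣i∣≤n : ∀ {i n} → ℤ.- (+ n) ℤ.≤ i → i ℤ.≤ + n → ℤ.∣ i ∣ ℕ.≤ n
∣i∣≤n {+ _} _ (ℤ.+≤+ m≤n) = m≤n
∣i∣≤n { -[1+ _ ]} {suc _} (ℤ.-≤- m≤n) _ = ℕ.s≤s m≤n

floor-≤ : ∀ t → fromℤ (ℚ.floor t) ≤ t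
floor-≤ t@(mkℚ n d _) rewrite fromℤ-normal (ℚ.floor t) =
  *≤* (subst₂ ℤ._≤_ refl (sym (ℤP.*-identityʳ n)) (ℤD.[n/d]*d≤n n (+ suc d)))

<-suc-floor : ∀ t → t < fromℤ (ℤ.suc (ℚ.floor t))
<-suc-floor t@(mkℚ n d _) rewrite fromℤ-normal (ℤ.suc (ℚ.floor t)) =
  *<* (subst₂ ℤ._<_ (sym (ℤP.*-identityʳ n)) suc-floor (ℤD.n<s[n/ℕd]*d n (suc d)))
  where
  suc-floor : ℤ.suc (n ℤD./ℕ suc d) ℤ.* + suc d ≡ ℤ.suc (ℚ.floor t) ℤ.* + suc d
  suc-floor = cong (λ i → ℤ.suc i ℤ.* + suc d) (sym (ℤD.div-pos-is-/ℕ n (suc d)))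

module _ {r p q : ℚ} where

  *-monoˡ-≤-≥0 : 0ℚ ≤ r → p ≤ q → r * p ≤ r * q
  *-monoˡ-≤-≥0 0≤r = ℚP.*-monoˡ-≤-nonNeg r {{ℚ.nonNegative 0≤r}}

  *-monoʳ-≤-≥0 : 0ℚ ≤ r → p ≤ q → p * r ≤ q * r
  *-monoʳ-≤-≥0 0≤r = ℚP.*-monoʳ-≤-nonNeg r {{ℚ.nonNegative 0≤r}}

  *-monoʳ-<->0 : 0ℚ < r → p < q → p * r < q * r
  *-monoʳ-<->0 0<r = ℚP.*-monoˡ-<-pos r {{ℚ.positive 0<r}}

  *-cancelʳ-≤->0 : 0ℚ < r → p * r ≤ q * r → p ≤ q
  *-cancelʳ-≤->0 0<r = ℚP.*-cancelʳ-≤-pos r {{ℚ.positive 0<r}}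

p≤∣p∣ : ∀ p → p ≤ ∣ p ∣
p≤∣p∣ p with ℚP.≤-total 0ℚ p
... | inj₁ 0≤p = ℚP.≤-reflexive (sym (ℚP.0≤p⇒∣p∣≡p 0≤p))
... | inj₂ p≤0 = ℚP.≤-trans p≤0 (ℚP.0≤∣p∣ p)

-∣p∣≤p : ∀ p → - ∣ p ∣ ≤ p
-∣p∣≤p p = subst₂ _≤_ (cong -_ (ℚP.∣-p∣≡∣p∣ p)) (⁻¹-involutive p) (ℚP.neg-antimono-≤ (p≤∣p∣ (- p)))

<⇒≱ : ∀ {p q} → p < q → q ≤ p → ⊥
<⇒≱ p<q q≤p = ℚP.<-irrefl refl (ℚP.<-≤-trans p<q q≤p)

p≤q⇒0≤q-p : ∀ {p q} → p ≤ q → 0ℚ ≤ q - p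
p≤q⇒0≤q-p {p} {q} p≤q = subst (_≤ q - p) (ℚP.+-inverseʳ p) (ℚP.+-monoˡ-≤ (- p) p≤q)

0<∣p∣ : ∀ p .{{_ : NonZero p}} → 0ℚ < ∣ p ∣
0<∣p∣ (mkℚ +[1+ _ ] _ _) = ℚP.positive⁻¹ _
0<∣p∣ (mkℚ -[1+ _ ] _ _) = ℚP.positive⁻¹ _

p÷q*q≡p : ∀ p q .{{_ : NonZero q}} → p ÷ q * q ≡ p
p÷q*q≡p p q = trans (ℚP.*-assoc p (ℚ.1/ q) q) (trans (cong (p *_) (ℚP.*-inverseˡ q)) (ℚP.*-identityʳ p))

∣p*q∣≡∣p∣*q : ∀ p {q} → 0ℚ ≤ q → ∣ p * q ∣ ≡ ∣ p ∣ * q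
∣p*q∣≡∣p∣*q p {q} 0≤q = trans (ℚP.∣p*q∣≡∣p∣*∣q∣ p q) (cong (∣ p ∣ *_) (ℚP.0≤p⇒∣p∣≡p 0≤q))

∣a-b∣≤w₂-w₁ : ∀ {w₁ w₂ a b} → w₁ ≤ a → a ≤ w₂ → w₁ ≤ b → b ≤ w₂ → ∣ a - b ∣ ≤ w₂ - w₁
∣a-b∣≤w₂-w₁ {w₁} {w₂} {a} {b} w₁≤a a≤w₂ w₁≤b b≤w₂ with ℚP.∣p∣≡p∨∣p∣≡-p (a - b)
... | inj₁ ∣a-b∣≡a-b = subst (_≤ w₂ - w₁) (sym ∣a-b∣≡a-b) (ℚP.+-mono-≤ a≤w₂ (ℚP.neg-antimono-≤ w₁≤b))
... | inj₂ ∣a-b∣≡b-a = subst (_≤ w₂ - w₁) (sym (trans ∣a-b∣≡b-a (⁻¹-anti-homo-// a b)))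
                        (ℚP.+-mono-≤ b≤w₂ (ℚP.neg-antimono-≤ w₁≤a))

module Pow (b : ℕ) .{{_ : ℕ.NonZero b}} where

  B : ℚ
  B = fromℤ (+ b)

  pow-neg-inverse : ∀ n → pow b -[1+ n ] * pow b (+ suc n) ≡ 1ℚ
  pow-neg-inverse n with b ℕ.^ suc n | ℕP.m^n≢0 b (suc n)
  ... | suc d | _ rewrite fromℤ-normal (+ suc d) | ℚP.normalize-coprime (Coprime.1-coprimeTo (suc d)) =
    ℚP.*-inverseˡ (mkℚ (+ suc d) 0 (Coprime.sym (Coprime.1-coprimeTo (suc d))))

  pow-+-suc : ∀ n → pow b (+ suc n) ≡ pow b (+ n) * B
  pow-+-suc n = begin
    fromℤ (+ (b ℕ.* b ℕ.^ n))         ≡⟨ cong fromℤ (trans (cong +_ (ℕP.*-comm b (b ℕ.^ n))) (ℤP.pos-* (b ℕ.^ n) b)) ⟩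
    fromℤ (+ (b ℕ.^ n) ℤ.* + b)       ≡⟨ fromℤ-* (+ (b ℕ.^ n)) (+ b) ⟩
    pow b (+ n) * B                   ∎
    where open ≡-Reasoning

  pow-suc : ∀ k → pow b (k ℤ.+ ℤ.1ℤ) ≡ pow b k * B
  pow-suc (+ n) = trans (cong (λ m → pow b (+ m)) (ℕP.+-comm n 1)) (pow-+-suc n)
  pow-suc -[1+ 0 ] = begin
    1ℚ                          ≡⟨ pow-neg-inverse 0 ⟨
    pow b -[1+ 0 ] * pow b (+ 1) ≡⟨ cong (pow b -[1+ 0 ] *_) (trans (pow-+-suc 0) (ℚP.*-identityˡ B)) ⟩
    pow b -[1+ 0 ] * B           ∎
    where open ≡-Reasoning
  pow-suc -[1+ suc n ] = begin
    c                     ≡⟨ ℚP.*-identityʳ c ⟨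
    c * 1ℚ                ≡⟨ cong (c *_) (pow-neg-inverse (suc n)) ⟨
    c * (a * pow b (+ suc (suc n))) ≡⟨ cong (λ t → c * (a * t)) (pow-+-suc (suc n)) ⟩
    c * (a * (N * B))     ≡⟨ regroup c a N B ⟩
    (a * B) * (c * N)     ≡⟨ cong ((a * B) *_) (pow-neg-inverse n) ⟩
    (a * B) * 1ℚ          ≡⟨ ℚP.*-identityʳ (a * B) ⟩
    a * B                 ∎
    where
    open ≡-Reasoning
    c = pow b -[1+ n ]
    a = pow b -[1+ suc n ]
    N = pow b (+ suc n)
    regroup : ∀ c a N B → c * (a * (N * B)) ≡ (a * B) * (c * N)
    regroup = solve 4 (λ c a N B → c :* (a :* (N :* B)) := (a :* B) :* (c :* N)) refl
      where open ℚ-Solver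

  pow-+-+ : ∀ k n → pow b (k ℤ.+ + n) ≡ pow b k * pow b (+ n)
  pow-+-+ k zero = trans (cong (pow b) (ℤP.+-identityʳ k)) (sym (ℚP.*-identityʳ (pow b k)))
  pow-+-+ k (suc n) = begin
    pow b (k ℤ.+ + suc n)          ≡⟨ cong (λ j → pow b (k ℤ.+ + j)) (ℕP.+-comm 1 n) ⟩
    pow b (k ℤ.+ (+ n ℤ.+ ℤ.1ℤ))   ≡⟨ cong (pow b) (ℤP.+-assoc k (+ n) ℤ.1ℤ) ⟨
    pow b (k ℤ.+ + n ℤ.+ ℤ.1ℤ)     ≡⟨ pow-suc (k ℤ.+ + n) ⟩
    pow b (k ℤ.+ + n) * B          ≡⟨ cong (_* B) (pow-+-+ k n) ⟩
    pow b k * pow b (+ n) * B      ≡⟨ ℚP.*-assoc (pow b k) (pow b (+ n)) B ⟩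
    pow b k * (pow b (+ n) * B)    ≡⟨ cong (pow b k *_) (pow-+-suc n) ⟨
    pow b k * pow b (+ suc n)      ∎
    where open ≡-Reasoning
  pow-+ : ∀ k m → pow b (k ℤ.+ m) ≡ pow b k * pow b m
  pow-+ k (+ n) = pow-+-+ k n
  pow-+ k m@(-[1+ n ]) = begin
    pow b (k ℤ.+ m)                         ≡⟨ ℚP.*-identityʳ _ ⟨
    pow b (k ℤ.+ m) * 1ℚ                    ≡⟨ cong (pow b (k ℤ.+ m) *_) (trans (ℚP.*-comm N (pow b m)) (pow-neg-inverse n)) ⟨
    pow b (k ℤ.+ m) * (N * pow b m)         ≡⟨ ℚP.*-assoc (pow b (k ℤ.+ m)) N (pow b m) ⟨
    pow b (k ℤ.+ m) * N * pow b m           ≡⟨ cong (_* pow b m) (pow-+-+ (k ℤ.+ m) (suc n)) ⟨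
    pow b (k ℤ.+ m ℤ.+ + suc n) * pow b m   ≡⟨ cong (λ j → pow b j * pow b m) cancel ⟩
    pow b k * pow b m                       ∎
    where
    open ≡-Reasoning
    N = pow b (+ suc n)
    cancel : k ℤ.+ m ℤ.+ + suc n ≡ k
    cancel = trans (ℤP.+-assoc k m (+ suc n)) (trans (cong (λ j → k ℤ.+ j) (ℤP.+-inverseˡ (+ suc n))) (ℤP.+-identityʳ k))

  pow-pos : ∀ k → 0ℚ < pow b k
  pow-pos (+ n) = fromℤ-mono-< (ℤ.+<+ (ℕP.m^n>0 b n))
  pow-pos -[1+ n ] with b ℕ.^ suc n | ℕP.m^n≢0 b (suc n)
  ... | suc d | _ = ℚP.positive⁻¹ _ {{ℚP.normalize-pos 1 (suc d)}}

  pow-mono-≤ : ∀ {k m} → k ℤ.≤ m → pow b k ≤ pow b m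
  pow-mono-≤ {k} {m} k≤m = begin
    pow b k                       ≡⟨ ℚP.*-identityʳ (pow b k) ⟨
    pow b k * 1ℚ                  ≤⟨ *-monoˡ-≤-≥0 (ℚP.<⇒≤ (pow-pos k)) 1≤pow-d ⟩
    pow b k * pow b (+ d)         ≡⟨ pow-+ k (+ d) ⟨
    pow b (k ℤ.+ + d)             ≡⟨ cong (λ j → pow b (k ℤ.+ j)) (ℤP.0≤i⇒+∣i∣≡i 0≤m-k) ⟩
    pow b (k ℤ.+ (m ℤ.- k))       ≡⟨ cong (pow b) (k+[m-k]≡m k m) ⟩
    pow b m                       ∎
    where
    open ℚP.≤-Reasoning
    0≤m-k : ℤ.0ℤ ℤ.≤ m ℤ.- k
    0≤m-k = ℤP.i≤j⇒0≤j-i k≤m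
    d = ℤ.∣ m ℤ.- k ∣
    1≤pow-d : 1ℚ ≤ pow b (+ d)
    1≤pow-d = fromℤ-mono-≤ (ℤ.+≤+ (ℕP.m^n>0 b d))
    k+[m-k]≡m : ∀ k m → k ℤ.+ (m ℤ.- k) ≡ m
    k+[m-k]≡m = solve 2 (λ k m → k :+ (m :- k) := m) refl
      where open ℤ-Solver

  ∣÷∣≤pow : ∀ x z ex ez .{{_ : NonZero x}} →
    ∣ z * pow b (ℤ.- ez) ∣ ≤ ∣ x * pow b (ℤ.- ex) ∣ → ∣ z ÷ x ∣ ≤ pow b (ez ℤ.- ex)
  ∣÷∣≤pow x z ex ez m[z]≤m[x] = *-cancelʳ-≤->0 (0<∣p∣ x) (begin
    ∣ z ÷ x ∣ * ∣ x ∣                        ≡⟨ ℚP.∣p*q∣≡∣p∣*∣q∣ (z ÷ x) x ⟨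
    ∣ z ÷ x * x ∣                            ≡⟨ cong ∣_∣ (p÷q*q≡p z x) ⟩
    ∣ z ∣                                    ≡⟨ cancel ∣ z ∣ ez ⟨
    ∣ z ∣ * pow b (ℤ.- ez) * pow b ez        ≤⟨ *-monoʳ-≤-≥0 (ℚP.<⇒≤ (pow-pos ez)) ∣z∣*β^-ez≤∣x∣*β^-ex ⟩
    ∣ x ∣ * pow b (ℤ.- ex) * pow b ez        ≡⟨ ℚP.*-assoc ∣ x ∣ (pow b (ℤ.- ex)) (pow b ez) ⟩
    ∣ x ∣ * (pow b (ℤ.- ex) * pow b ez)      ≡⟨ cong (∣ x ∣ *_) (pow-+ (ℤ.- ex) ez) ⟨
    ∣ x ∣ * pow b (ℤ.- ex ℤ.+ ez)            ≡⟨ ℚP.*-comm ∣ x ∣ _ ⟩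
    pow b (ℤ.- ex ℤ.+ ez) * ∣ x ∣            ≡⟨ cong (λ e → pow b e * ∣ x ∣) (ℤP.+-comm (ℤ.- ex) ez) ⟩
    pow b (ez ℤ.- ex) * ∣ x ∣                ∎)
    where
    open ℚP.≤-Reasoning
    ∣z∣*β^-ez≤∣x∣*β^-ex : ∣ z ∣ * pow b (ℤ.- ez) ≤ ∣ x ∣ * pow b (ℤ.- ex)
    ∣z∣*β^-ez≤∣x∣*β^-ex = subst₂ _≤_ (∣p*q∣≡∣p∣*q z (ℚP.<⇒≤ (pow-pos (ℤ.- ez))))
      (∣p*q∣≡∣p∣*q x (ℚP.<⇒≤ (pow-pos (ℤ.- ex)))) m[z]≤m[x]
    cancel : ∀ a e → a * pow b (ℤ.- e) * pow b e ≡ a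
    cancel a e = begin-equality
      a * pow b (ℤ.- e) * pow b e   ≡⟨ ℚP.*-assoc a _ _ ⟩
      a * (pow b (ℤ.- e) * pow b e) ≡⟨ cong (a *_) (pow-+ (ℤ.- e) e) ⟨
      a * pow b (ℤ.- e ℤ.+ e)       ≡⟨ cong (λ k → a * pow b k) (ℤP.+-inverseˡ e) ⟩
      a * 1ℚ                        ≡⟨ ℚP.*-identityʳ a ⟩
      a                             ∎

record Bracket (P : ℚ → Set) (q w : ℚ) : Set where
  constructor bracket
  field
    lower upper : ℚ
    lower∈P : P lower
    upper∈P : P upper
    lower≤q : lower ≤ q
    q≤upper : q ≤ upper
    width≤ : upper - lower ≤ w

widen : ∀ {P q w w′} → w ≤ w′ → Bracket P q w → Bracket P q w′
widen w≤w′ (bracket y₁ y₂ y₁∈P y₂∈P y₁≤q q≤y₂ width≤) =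
  bracket y₁ y₂ y₁∈P y₂∈P y₁≤q q≤y₂ (ℚP.≤-trans width≤ w≤w′)

grid-bracket : ∀ {u} (P : ℚ → Set) (K : ℕ) → 0ℚ < u →
  (∀ k → ℤ.∣ k ∣ ℕ.≤ K → P (fromℤ k * u)) →
  ∀ q → ∣ q ∣ ≤ fromℤ (+ K) * u → Bracket P q u
grid-bracket {u} P K 0<u grid q ∣q∣≤Ku = bracket-at (t ℚP.≤? fromℤ k)
  where
  instance
    u≢0 : NonZero u
    u≢0 = ℚ.>-nonZero 0<u
  t = q ÷ u
  k = ℚ.floor t
  t*u≡q : t * u ≡ q
  t*u≡q = p÷q*q≡p q u
  ∣t∣≤K : ∣ t ∣ ≤ fromℤ (+ K)
  ∣t∣≤K = *-cancelʳ-≤->0 0<u (subst (_≤ fromℤ (+ K) * u) ∣q∣≡∣t∣*u ∣q∣≤Ku)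
    where
    ∣q∣≡∣t∣*u : ∣ q ∣ ≡ ∣ t ∣ * u
    ∣q∣≡∣t∣*u = trans (cong ∣_∣ (sym t*u≡q)) (∣p*q∣≡∣p∣*q t (ℚP.<⇒≤ 0<u))
  k≤K : k ℤ.≤ + K
  k≤K = fromℤ-cancel-≤ (ℚP.≤-trans (floor-≤ t) (ℚP.≤-trans (p≤∣p∣ t) ∣t∣≤K))
  -K≤k : ℤ.- (+ K) ℤ.≤ k
  -K≤k = i<suc[j]⇒i≤j (fromℤ-cancel-< (ℚP.≤-<-trans -K≤t (<-suc-floor t)))
    where
    -K≤t : fromℤ (ℤ.- (+ K)) ≤ t
    -K≤t = subst (_≤ t) (sym (fromℤ-neg (+ K))) (ℚP.≤-trans (ℚP.neg-antimono-≤ ∣t∣≤K) (-∣p∣≤p t))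
  scaled : ∀ {a b} → a ≤ b → a * u ≤ b * u
  scaled = *-monoʳ-≤-≥0 (ℚP.<⇒≤ 0<u)
  bracket-at : Dec (t ≤ fromℤ k) → Bracket P q u
  bracket-at (yes t≤k) = bracket (fromℤ k * u) (fromℤ k * u) (grid k ∣k∣≤K) (grid k ∣k∣≤K)
    (subst (fromℤ k * u ≤_) t*u≡q (scaled (floor-≤ t))) (subst (_≤ fromℤ k * u) t*u≡q (scaled t≤k))
    (subst (_≤ u) (sym (ℚP.+-inverseʳ (fromℤ k * u))) (ℚP.<⇒≤ 0<u))
    where ∣k∣≤K = ∣i∣≤n -K≤k k≤K
  bracket-at (no t≰k) = bracket (fromℤ k * u) (fromℤ (ℤ.suc k) * u) (grid k ∣k∣≤K) (grid (ℤ.suc k) ∣suc[k]∣≤K)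
    (subst (fromℤ k * u ≤_) t*u≡q (scaled (floor-≤ t)))
    (subst (_≤ fromℤ (ℤ.suc k) * u) t*u≡q (scaled (ℚP.<⇒≤ (<-suc-floor t))))
    (ℚP.≤-reflexive (trans (cong (λ a → a * u - fromℤ k * u) (fromℤ-+ ℤ.1ℤ k)) (unit-step (fromℤ k) u)))
    where
    ∣k∣≤K = ∣i∣≤n -K≤k k≤K
    suc[k]≤K : ℤ.suc k ℤ.≤ + K
    suc[k]≤K = ℤP.i<j⇒suc[i]≤j (fromℤ-cancel-< {k} (ℚP.<-≤-trans (ℚP.≰⇒> t≰k) (ℚP.≤-trans (p≤∣p∣ t) ∣t∣≤K)))
    ∣suc[k]∣≤K = ∣i∣≤n (ℤP.≤-trans -K≤k (ℤP.i≤suc[i] k)) suc[k]≤K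
    unit-step : ∀ a u → (1ℚ + a) * u - a * u ≡ u
    unit-step = solve 2 (λ a u → (con 1ℚ :+ a) :* u :- a :* u := u) refl
      where open ℚ-Solver

ScaledBy : ℚ → (ℚ → Set) → ℚ → Set
ScaledBy x P v = ∃[ y ] (P y × v ≡ x * y)

scale-bracket : ∀ {P q w} x → Bracket P q w → Bracket (ScaledBy x P) (x * q) (∣ x ∣ * w)
scale-bracket {w = w} x (bracket y₁ y₂ y₁∈P y₂∈P y₁≤q q≤y₂ width≤) with ℚP.≤-total 0ℚ x
... | inj₁ 0≤x = bracket (x * y₁) (x * y₂) (y₁ , y₁∈P , refl) (y₂ , y₂∈P , refl)
  (*-monoˡ-≤-≥0 0≤x y₁≤q) (*-monoˡ-≤-≥0 0≤x q≤y₂)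
  (subst (_≤ ∣ x ∣ * w) (trans (cong (_* (y₂ - y₁)) (ℚP.0≤p⇒∣p∣≡p 0≤x)) (sym (x*b-x*a≡x*[b-a] x y₁ y₂)))
    (*-monoˡ-≤-≥0 (ℚP.0≤∣p∣ x) width≤))
  where
  x*b-x*a≡x*[b-a] : ∀ x a b → x * b - x * a ≡ x * (b - a)
  x*b-x*a≡x*[b-a] = solve 3 (λ x a b → x :* b :- x :* a := x :* (b :- a)) refl
    where open ℚ-Solver
... | inj₂ x≤0 = bracket (x * y₂) (x * y₁) (y₂ , y₂∈P , refl) (y₁ , y₁∈P , refl)
  (ℚP.*-monoˡ-≤-nonPos x {{ℚ.nonPositive x≤0}} q≤y₂) (ℚP.*-monoˡ-≤-nonPos x {{ℚ.nonPositive x≤0}} y₁≤q)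
  (subst (_≤ ∣ x ∣ * w) (trans (cong (_* (y₂ - y₁)) ∣x∣≡-x) (sym (x*a-x*b≡-x*[b-a] x y₁ y₂)))
    (*-monoˡ-≤-≥0 (ℚP.0≤∣p∣ x) width≤))
  where
  ∣x∣≡-x : ∣ x ∣ ≡ - x
  ∣x∣≡-x = trans (sym (ℚP.∣-p∣≡∣p∣ x)) (ℚP.0≤p⇒∣p∣≡p (ℚP.neg-antimono-≤ x≤0))
  x*a-x*b≡-x*[b-a] : ∀ x a b → x * a - x * b ≡ (- x) * (b - a)
  x*a-x*b≡-x*[b-a] = solve 3 (λ x a b → x :* a :- x :* b := (:- x) :* (b :- a)) refl
    where open ℚ-Solver

≤ᴱ-refl : ∀ {a} → a ≤ᴱ a
≤ᴱ-refl { -∞} = -∞≤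
≤ᴱ-refl {+∞} = ≤+∞
≤ᴱ-refl {fin q} = fin≤ ℚP.≤-refl

≤ᴱ-antisym : ∀ {a b} → a ≤ᴱ b → b ≤ᴱ a → a ≡ b
≤ᴱ-antisym -∞≤ -∞≤ = refl
≤ᴱ-antisym ≤+∞ ≤+∞ = refl
≤ᴱ-antisym (fin≤ q≤r) (fin≤ r≤q) = cong fin (ℚP.≤-antisym q≤r r≤q)

<ᴱ⇒≱ᴱ : ∀ {a b} → a <ᴱ b → b ≤ᴱ a → ⊥
<ᴱ⇒≱ᴱ (fin< q<r) (fin≤ r≤q) = <⇒≱ q<r r≤q
<ᴱ⇒≱ᴱ -∞<fin ()
<ᴱ⇒≱ᴱ -∞<+∞ ()
<ᴱ⇒≱ᴱ fin<+∞ ()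

dist-fin-≤ : ∀ {a b w} → 0ℚ ≤ w → ∣ a - b ∣ ≤ w → dist (fin a) (fin b) ≤ᴱ fin w
dist-fin-≤ {a} {b} 0≤w ∣a-b∣≤w with a ℚ.≟ b
... | yes _ = fin≤ 0≤w
... | no _ = fin≤ ∣a-b∣≤w

data Position (w₁ w₂ : ℚ) : ℚ̄ → Set where
  below : ∀ {a} → a ≤ᴱ fin w₁ → Position w₁ w₂ a
  above : ∀ {a} → fin w₂ ≤ᴱ a → Position w₁ w₂ a
  inside : ∀ {q} → w₁ ≤ q → q ≤ w₂ → Position w₁ w₂ (fin q)

position : ∀ w₁ w₂ a → Position w₁ w₂ a
position w₁ w₂ -∞ = below -∞≤
position w₁ w₂ +∞ = above ≤+∞
position w₁ w₂ (fin q) with q ℚ.≤? w₁ | w₂ ℚ.≤? q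
... | yes q≤w₁ | _ = below (fin≤ q≤w₁)
... | no _ | yes w₂≤q = above (fin≤ w₂≤q)
... | no q≰w₁ | no w₂≰q = inside (ℚP.<⇒≤ (ℚP.≰⇒> q≰w₁)) (ℚP.<⇒≤ (ℚP.≰⇒> w₂≰q))

-- Two points of I farther apart than the width cannot both lie inside the bracket, and a point
-- outside it puts the endpoint between it and q into I by convexity.
interval-meets-bracket : ∀ {I P q w c} → IsInterval I → DiamGE I c → I (fin q) →
  Bracket P q w → w < c → ∃[ v ] (P v × I (fin v))
interval-meets-bracket {I} {P} {q} {w} {c} I-interval diam q∈I (bracket w₁ w₂ w₁∈P w₂∈P w₁≤q q≤w₂ width≤) w<c
  with diam (w₂ - w₁) (ℚP.≤-<-trans width≤ w<c)
... | inj₁ w₂-w₁<0 = ⊥-elim (<⇒≱ w₂-w₁<0 (p≤q⇒0≤q-p (ℚP.≤-trans w₁≤q q≤w₂)))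
... | inj₂ (a , b , a∈I , b∈I , w₂-w₁<d) = endpoint a∈I b∈I (position w₁ w₂ a) (position w₁ w₂ b) w₂-w₁<d
  where
  lower-end : ∀ {a} → I a → a ≤ᴱ fin w₁ → ∃[ v ] (P v × I (fin v))
  lower-end a∈I a≤w₁ = w₁ , w₁∈P , I-interval _ _ _ a∈I q∈I a≤w₁ (fin≤ w₁≤q)
  upper-end : ∀ {a} → I a → fin w₂ ≤ᴱ a → ∃[ v ] (P v × I (fin v))
  upper-end a∈I w₂≤a = w₂ , w₂∈P , I-interval _ _ _ q∈I a∈I (fin≤ q≤w₂) w₂≤a
  endpoint : ∀ {a b} → I a → I b → Position w₁ w₂ a → Position w₁ w₂ b →
    fin (w₂ - w₁) <ᴱ dist a b → ∃[ v ] (P v × I (fin v))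
  endpoint a∈I _ (below a≤w₁) _ _ = lower-end a∈I a≤w₁
  endpoint a∈I _ (above w₂≤a) _ _ = upper-end a∈I w₂≤a
  endpoint _ b∈I (inside _ _) (below b≤w₁) _ = lower-end b∈I b≤w₁
  endpoint _ b∈I (inside _ _) (above w₂≤b) _ = upper-end b∈I w₂≤b
  endpoint _ _ (inside w₁≤a a≤w₂) (inside w₁≤b b≤w₂) w₂-w₁<d
    = ⊥-elim (<ᴱ⇒≱ᴱ w₂-w₁<d
        (dist-fin-≤ (p≤q⇒0≤q-p (ℚP.≤-trans w₁≤a a≤w₂)) (∣a-b∣≤w₂-w₁ w₁≤a a≤w₂ w₁≤b b≤w₂)))

module _ (fmt : Format) where
  open Format fmt

  instance
    β≢0 : ℕ.NonZero β
    β≢0 = ℕ.>-nonZero (ℕP.<-trans (ℕ.s≤s ℕ.z≤n) 2≤β)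

  open Pow β

  scaled∈F : ∀ M {e} → ℤ.∣ M ∣ ℕ.< β ℕ.^ p → emin ℤ.≤ e → e ℤ.≤ emax →
    InF fmt (fromℤ M * pow β (Qof fmt e))
  scaled∈F (+ zero) {e} _ _ _ = inj₂ (ℚP.*-zeroˡ (pow β (Qof fmt e)))
  scaled∈F M@(+ suc _) {e} M<β^p emin≤e e≤emax = inj₁ (M , e , ℕ.s≤s ℕ.z≤n , M<β^p , emin≤e , e≤emax , refl)
  scaled∈F M@(-[1+ _ ]) {e} M<β^p emin≤e e≤emax = inj₁ (M , e , ℕ.s≤s ℕ.z≤n , M<β^p , emin≤e , e≤emax , refl)

  -‿∈F : ∀ {q} → InF fmt q → InF fmt (- q)
  -‿∈F (inj₂ refl) = inj₂ refl
  -‿∈F (inj₁ (M , e , 0<M , M<β^p , emin≤e , e≤emax , refl)) =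
    inj₁ ( ℤ.- M , e
         , subst (0 ℕ.<_) (sym (ℤP.∣-i∣≡∣i∣ M)) 0<M , subst (ℕ._< β ℕ.^ p) (sym (ℤP.∣-i∣≡∣i∣ M)) M<β^p
         , emin≤e , e≤emax , trans (ℚP.neg-distribˡ-* (fromℤ M) _) (cong (_* _) (sym (fromℤ-neg M))))

  ∣∣-∈F : ∀ {q} → InF fmt ∣ q ∣ → InF fmt q
  ∣∣-∈F {q} ∣q∣∈F with ℚP.∣p∣≡p∨∣p∣≡-p q
  ... | inj₁ ∣q∣≡q = subst (InF fmt) ∣q∣≡q ∣q∣∈F
  ... | inj₂ ∣q∣≡-q = subst (InF fmt) (trans (cong -_ ∣q∣≡-q) (⁻¹-involutive q)) (-‿∈F ∣q∣∈F)

  pow∈F : ∀ {e} → emin ℤ.≤ e → e ℤ.≤ emax → InF fmt (pow β e)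
  pow∈F {e} emin≤e e≤emax = subst (InF fmt) β^[p-1]*ulp≡β^e (scaled∈F (+ (β ℕ.^ p-1)) β^[p-1]<β^p emin≤e e≤emax)
    where
    p-1 = ℕ.pred p
    suc[p-1]≡p : suc p-1 ≡ p
    suc[p-1]≡p = ℕP.suc-pred p {{ℕ.>-nonZero 1≤p}}
    β^[p-1]<β^p : β ℕ.^ p-1 ℕ.< β ℕ.^ p
    β^[p-1]<β^p = ℕP.^-monoʳ-< β 2≤β (subst (p-1 ℕ.<_) suc[p-1]≡p ℕP.≤-refl)
    β^[p-1]*ulp≡β^e : fromℤ (+ (β ℕ.^ p-1)) * pow β (Qof fmt e) ≡ pow β e
    β^[p-1]*ulp≡β^e = trans (sym (pow-+ (+ p-1) (Qof fmt e))) (cong (pow β) (begin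
      + p-1 ℤ.+ (e ℤ.- + p ℤ.+ ℤ.1ℤ)             ≡⟨ cong (λ n → + p-1 ℤ.+ (e ℤ.- + n ℤ.+ ℤ.1ℤ)) suc[p-1]≡p ⟨
      + p-1 ℤ.+ (e ℤ.- (ℤ.1ℤ ℤ.+ + p-1) ℤ.+ ℤ.1ℤ) ≡⟨ P+Qof[e]≡e (+ p-1) e ⟩
      e                                          ∎))
      where
      open ≡-Reasoning
      P+Qof[e]≡e : ∀ P e → P ℤ.+ (e ℤ.- (ℤ.1ℤ ℤ.+ P) ℤ.+ ℤ.1ℤ) ≡ e
      P+Qof[e]≡e = solve 2 (λ P e → P :+ (e :- (con ℤ.1ℤ :+ P) :+ con ℤ.1ℤ) := e) refl
        where open ℤ-Solver

  Qof-mono-≤ : ∀ {e e′} → e ℤ.≤ e′ → Qof fmt e ℤ.≤ Qof fmt e′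
  Qof-mono-≤ e≤e′ = ℤP.+-monoˡ-≤ ℤ.1ℤ (ℤP.+-monoˡ-≤ (ℤ.- + p) e≤e′)

  maxF : ℚ
  maxF = fromℤ (+ ℕ.pred (β ℕ.^ p)) * pow β (Qof fmt emax)

  maxF-isMaxF : IsMaxF fmt maxF
  maxF-isMaxF = scaled∈F (+ ℕ.pred (β ℕ.^ p)) pred[β^p]<β^p emin≤emax ℤP.≤-refl , ≤maxF
    where
    pred[β^p]<β^p : ℕ.pred (β ℕ.^ p) ℕ.< β ℕ.^ p
    pred[β^p]<β^p = ℕP.m≤pred[n]⇒suc[m]≤n {{ℕP.m^n≢0 β p}} ℕP.≤-refl
    0≤pred[β^p] : 0ℚ ≤ fromℤ (+ ℕ.pred (β ℕ.^ p))
    0≤pred[β^p] = fromℤ-mono-≤ {+ 0} {+ ℕ.pred (β ℕ.^ p)} (ℤ.+≤+ ℕ.z≤n)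
    ≤maxF : ∀ f → InF fmt f → f ≤ maxF
    ≤maxF f (inj₂ refl) = subst (_≤ maxF) (ℚP.*-zeroˡ (pow β (Qof fmt emax)))
      (*-monoʳ-≤-≥0 (ℚP.<⇒≤ (pow-pos (Qof fmt emax))) 0≤pred[β^p])
    ≤maxF f (inj₁ (M , e , _ , M<β^p , _ , e≤emax , refl)) = begin
      fromℤ M * ulp                       ≤⟨ p≤∣p∣ _ ⟩
      ∣ fromℤ M * ulp ∣                   ≡⟨ ∣p*q∣≡∣p∣*q (fromℤ M) (ℚP.<⇒≤ (pow-pos (Qof fmt e))) ⟩
      ∣ fromℤ M ∣ * ulp                   ≡⟨ cong (_* ulp) (fromℤ-∣∣ M) ⟨
      fromℤ (+ ℤ.∣ M ∣) * ulp             ≤⟨ *-monoʳ-≤-≥0 (ℚP.<⇒≤ (pow-pos (Qof fmt e)))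
                                               (fromℤ-mono-≤ (ℤ.+≤+ (ℕP.<⇒≤pred M<β^p))) ⟩
      fromℤ (+ ℕ.pred (β ℕ.^ p)) * ulp    ≤⟨ *-monoˡ-≤-≥0 0≤pred[β^p] (pow-mono-≤ (Qof-mono-≤ e≤emax)) ⟩
      maxF                                ∎
      where
      open ℚP.≤-Reasoning
      ulp = pow β (Qof fmt e)

  β^p*ulp≡β^[e+1] : ∀ e → fromℤ (+ (β ℕ.^ p)) * pow β (Qof fmt e) ≡ pow β (ℤ.suc e)
  β^p*ulp≡β^[e+1] e = trans (sym (pow-+ (+ p) (Qof fmt e))) (cong (pow β) (p+Qof[e]≡1+e (+ p) e))
    where
    p+Qof[e]≡1+e : ∀ P e → P ℤ.+ (e ℤ.- P ℤ.+ ℤ.1ℤ) ≡ ℤ.1ℤ ℤ.+ e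
    p+Qof[e]≡1+e = solve 2 (λ P e → P :+ (e :- P :+ con ℤ.1ℤ) := con ℤ.1ℤ :+ e) refl
      where open ℤ-Solver

  float-bracket : ∀ {q} e → pow β emin ≤ ∣ q ∣ → ∣ q ∣ ≤ pow β (ℤ.suc e) → ∣ q ∣ ≤ maxF →
    Bracket (InF fmt) q (pow β (Qof fmt e))
  float-bracket {q} e β^emin≤∣q∣ ∣q∣≤β^[e+1] ∣q∣≤maxF with ℤ.suc e ℤP.≤? emin | ℤ.suc e ℤP.≤? emax
  ... | yes e+1≤emin | _ = bracket q q q∈F q∈F ℚP.≤-refl ℚP.≤-refl
    (subst (_≤ _) (sym (ℚP.+-inverseʳ q)) (ℚP.<⇒≤ (pow-pos (Qof fmt e))))
    where
    ∣q∣≡β^emin : ∣ q ∣ ≡ pow β emin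
    ∣q∣≡β^emin = ℚP.≤-antisym (ℚP.≤-trans ∣q∣≤β^[e+1] (pow-mono-≤ e+1≤emin)) β^emin≤∣q∣
    q∈F : InF fmt q
    q∈F = ∣∣-∈F (subst (InF fmt) (sym ∣q∣≡β^emin) (pow∈F ℤP.≤-refl emin≤emax))
  ... | no e+1≰emin | yes e+1≤emax =
    grid-bracket (InF fmt) (β ℕ.^ p) (pow-pos (Qof fmt e)) on-grid q
      (subst (∣ q ∣ ≤_) (sym (β^p*ulp≡β^[e+1] e)) ∣q∣≤β^[e+1])
    where
    emin≤e : emin ℤ.≤ e
    emin≤e = i<suc[j]⇒i≤j (ℤP.≰⇒> e+1≰emin)
    on-grid : ∀ k → ℤ.∣ k ∣ ℕ.≤ β ℕ.^ p → InF fmt (fromℤ k * pow β (Qof fmt e))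
    on-grid k ∣k∣≤β^p with ℕP.m≤n⇒m<n∨m≡n ∣k∣≤β^p
    ... | inj₁ ∣k∣<β^p = scaled∈F k ∣k∣<β^p emin≤e (ℤP.≤-trans (ℤP.i≤suc[i] e) e+1≤emax)
    -- here k β^Q(e) = ± β^(e+1), a float of the next binade
    ... | inj₂ ∣k∣≡β^p = ∣∣-∈F (subst (InF fmt) β^[e+1]≡∣k*ulp∣
                           (pow∈F (ℤP.≤-trans emin≤e (ℤP.i≤suc[i] e)) e+1≤emax))
      where
      β^[e+1]≡∣k*ulp∣ : pow β (ℤ.suc e) ≡ ∣ fromℤ k * pow β (Qof fmt e) ∣
      β^[e+1]≡∣k*ulp∣ = begin
        pow β (ℤ.suc e)                         ≡⟨ β^p*ulp≡β^[e+1] e ⟨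
        fromℤ (+ (β ℕ.^ p)) * pow β (Qof fmt e) ≡⟨ cong (λ n → fromℤ (+ n) * pow β (Qof fmt e)) ∣k∣≡β^p ⟨
        fromℤ (+ ℤ.∣ k ∣) * pow β (Qof fmt e)   ≡⟨ cong (_* pow β (Qof fmt e)) (fromℤ-∣∣ k) ⟩
        ∣ fromℤ k ∣ * pow β (Qof fmt e)         ≡⟨ ∣p*q∣≡∣p∣*q (fromℤ k) (ℚP.<⇒≤ (pow-pos (Qof fmt e))) ⟨
        ∣ fromℤ k * pow β (Qof fmt e) ∣         ∎
        where open ≡-Reasoning
  ... | no _ | no e+1≰emax =
    widen (pow-mono-≤ (Qof-mono-≤ emax≤e))
      (grid-bracket (InF fmt) (ℕ.pred (β ℕ.^ p)) (pow-pos (Qof fmt emax)) on-grid q ∣q∣≤maxF)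
    where
    emax≤e : emax ℤ.≤ e
    emax≤e = i<suc[j]⇒i≤j (ℤP.≰⇒> e+1≰emax)
    on-grid : ∀ k → ℤ.∣ k ∣ ℕ.≤ ℕ.pred (β ℕ.^ p) → InF fmt (fromℤ k * pow β (Qof fmt emax))
    on-grid k ∣k∣≤pred[β^p] =
      scaled∈F k (ℕP.m≤pred[n]⇒suc[m]≤n {{ℕP.m^n≢0 β p}} ∣k∣≤pred[β^p]) emin≤emax ℤP.≤-refl

  ∣x∣<β^[e+1] : ∀ {x e} → IsE fmt x e → ∣ x ∣ < pow β (e ℤ.+ ℤ.1ℤ)
  ∣x∣<β^[e+1] (inj₁ (_ , _ , ∣x∣<β^[e+1])) = ∣x∣<β^[e+1]
  ∣x∣<β^[e+1] (inj₂ (∣x∣<β^emin , refl)) = ℚP.<-≤-trans ∣x∣<β^emin (pow-mono-≤ (ℤP.i≤i+j emin ℤ.1ℤ))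

  product-bracket : ∀ x z ex ez .{{_ : NonZero x}} → IsE fmt x ex →
    ∣ z * pow β (ℤ.- ez) ∣ ≤ ∣ x * pow β (ℤ.- ex) ∣ →
    pow β emin ≤ ∣ z ÷ x ∣ → ∣ z ÷ x ∣ ≤ maxF →
    ∃[ w ] (w < pow β (Qof fmt ez) × Bracket (ScaledBy x (InF fmt)) z w)
  product-bracket x z ex ez E[x] m[z]≤m[x] β^emin≤∣q∣ ∣q∣≤maxF =
    ∣ x ∣ * ulp , ∣x∣*ulp<β^Q[z] ,
    subst (λ v → Bracket (ScaledBy x (InF fmt)) v (∣ x ∣ * ulp)) (trans (ℚP.*-comm x (z ÷ x)) (p÷q*q≡p z x))
      (scale-bracket x (float-bracket e β^emin≤∣q∣ ∣q∣≤β^[e+1] ∣q∣≤maxF))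
    where
    -- |q| ≤ β^(e+1) and |x| < β^(ex+1), so a grid of spacing β^Q(e) scales to one finer than β^Q(ez).
    e = ez ℤ.- (ex ℤ.+ ℤ.1ℤ)
    ulp = pow β (Qof fmt e)
    ∣q∣≤β^[e+1] : ∣ z ÷ x ∣ ≤ pow β (ℤ.suc e)
    ∣q∣≤β^[e+1] = subst (λ k → ∣ z ÷ x ∣ ≤ pow β k) ez-ex≡1+e (∣÷∣≤pow x z ex ez m[z]≤m[x])
      where
      open ℤ-Solver
      ez-ex≡1+e : ez ℤ.- ex ≡ ℤ.suc e
      ez-ex≡1+e = solve 2 (λ ex ez → ez :- ex := con ℤ.1ℤ :+ (ez :- (ex :+ con ℤ.1ℤ))) refl ex ez
    ∣x∣*ulp<β^Q[z] : ∣ x ∣ * ulp < pow β (Qof fmt ez)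
    ∣x∣*ulp<β^Q[z] = begin-strict
      ∣ x ∣ * ulp                        <⟨ *-monoʳ-<->0 (pow-pos (Qof fmt e)) (∣x∣<β^[e+1] E[x]) ⟩
      pow β (ex ℤ.+ ℤ.1ℤ) * ulp          ≡⟨ pow-+ (ex ℤ.+ ℤ.1ℤ) (Qof fmt e) ⟨
      pow β (ex ℤ.+ ℤ.1ℤ ℤ.+ Qof fmt e)  ≡⟨ cong (pow β) (ex+1+Qof[e]≡Qof[ez] ex ez (+ p)) ⟩
      pow β (Qof fmt ez)                 ∎
      where
      open ℚP.≤-Reasoning
      open ℤ-Solver
      ex+1+Qof[e]≡Qof[ez] : ∀ ex ez P →
        ex ℤ.+ ℤ.1ℤ ℤ.+ (ez ℤ.- (ex ℤ.+ ℤ.1ℤ) ℤ.- P ℤ.+ ℤ.1ℤ) ≡ ez ℤ.- P ℤ.+ ℤ.1ℤ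
      ex+1+Qof[e]≡Qof[ez] = solve 3 (λ ex ez P →
        ex :+ con ℤ.1ℤ :+ (ez :- (ex :+ con ℤ.1ℤ) :- P :+ con ℤ.1ℤ) := ez :- P :+ con ℤ.1ℤ) refl

  module _ {fl : ℚ̄ → ℚ̄} (rounding : IsRounding fmt fl) where

    rounding-fixes-F̄ : ∀ {a} → InF̄ fmt a → fl a ≡ a
    rounding-fixes-F̄ {a} a∈F̄ with proj₂ rounding a
    ... | inj₁ (_ , fl[a]≤a , maximal) = ≤ᴱ-antisym fl[a]≤a (maximal a a∈F̄ ≤ᴱ-refl)
    ... | inj₂ (_ , a≤fl[a] , minimal) = ≤ᴱ-antisym (minimal a a∈F̄ ≤ᴱ-refl) a≤fl[a]

    rounding-∈F̄ : ∀ a → InF̄ fmt (fl a)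
    rounding-∈F̄ a with proj₂ rounding a
    ... | inj₁ (fl[a]∈F̄ , _) = fl[a]∈F̄
    ... | inj₂ (fl[a]∈F̄ , _) = fl[a]∈F̄

    preimage-isInterval : ∀ {Z} → IsFPInterval fmt Z → IsInterval (λ a → Z (fl a))
    preimage-isInterval {Z} (X , X-interval , Z⇔X∩F̄) a b c Z[fl[a]] Z[fl[c]] a≤b b≤c =
      proj₂ (Z⇔X∩F̄ (fl b))
        ( X-interval (fl a) (fl b) (fl c) (Z⊆X Z[fl[a]]) (Z⊆X Z[fl[c]])
            (proj₁ rounding a b a≤b) (proj₁ rounding b c b≤c)
        , rounding-∈F̄ b)
      where
      Z⊆X : ∀ {d} → Z (fl d) → X (fl d)
      Z⊆X {d} Z[fl[d]] = proj₁ (proj₁ (Z⇔X∩F̄ (fl d)) Z[fl[d]])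

    ⊆preimage : ∀ {Z a} → IsFPInterval fmt Z → Z a → Z (fl a)
    ⊆preimage {Z} (_ , _ , Z⇔X∩F̄) a∈Z = subst Z (sym (rounding-fixes-F̄ (proj₂ (proj₁ (Z⇔X∩F̄ _) a∈Z)))) a∈Z

mainTheorem12 : (fmt : Format) (fl : ℚ̄ → ℚ̄) → IsRounding fmt fl →
    (Z : ℚ̄ → Set) → IsFPInterval fmt Z →
    (x z : ℚ) → InF* fmt x → Z (fin z) →
    (ex ez : ℤ) → IsE fmt x ex → IsE fmt z ez →
    DiamGE (λ a → Z (fl a)) (pow (Format.β fmt) (Qof fmt ez)) →
    ∣ z * pow (Format.β fmt) (ℤ.- ez) ∣ ≤ ∣ x * pow (Format.β fmt) (ℤ.- ex) ∣ →
    .{{_ : NonZero x}} →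
    pow (Format.β fmt) (Format.emin fmt) ≤ ∣ z ÷ x ∣ →
    (∀ m → IsMaxF fmt m → ∣ z ÷ x ∣ ≤ m) →
    Feasible fmt fl (fin x) Z
mainTheorem12 fmt fl rounding Z Z-isFPInterval x z _ z∈Z ex ez E[x] _ diam m[z]≤m[x] β^emin≤∣q∣ ∣q∣≤maxF
  with product-bracket fmt x z ex ez E[x] m[z]≤m[x] β^emin≤∣q∣ (∣q∣≤maxF (maxF fmt) (maxF-isMaxF fmt))
... | w , w<β^Q[z] , z-bracket
  with interval-meets-bracket (preimage-isInterval fmt rounding Z-isFPInterval) diam
         (⊆preimage fmt rounding Z-isFPInterval z∈Z) z-bracket w<β^Q[z]
... | _ , (y , y∈F , refl) , fl[xy]∈Z = fin y , fin (x * y) , y∈F , ff , fl[xy]∈Z
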